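{- Let $l\ge 3$ be an integer, let $G$ be a graph and $v$ a vertex of $G$ such that $G$ does not contain two intersecting $v$-paths. Then all $v$-paths in $G$ have the same vertex set.
   Context: All graphs are finite, simple and undirected. An $l$-path is a simple path with exactly $l$ vertices; $V(P)$ denotes the vertex set of a path $P$. A $v$-path is an $l$-path containing $v$. Two $v$-paths $P,P'$ are intersecting if $V(P)\neq V(P')$ and $V(P)\cap V(P')$ contains at least one vertex other than $v$. -}

module Defs where

open import Data.Nat using (ℕ; suc)
open import Data.Fin using (Fin)
open import Data.Vec using (Vec; []; _∷_)
open import Data.Vec.Membership.Propositional using (_∈_)
open import Data.Vec.Relation.Unary.Unique.Propositional using (Unique)
open import Data.Product using (_×_; ∃-syntax)
open import Relation.Binary.PropositionalEquality using (_≡_)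
open import Relation.Nullary using (¬_)
open import Level using (0ℓ; suc)

record Graph (n : ℕ) : Set₁ where
  field
    Adj   : Fin n → Fin n → Set
    sym   : ∀ {x y} → Adj x y → Adj y x
    irrefl : ∀ {x} → ¬ Adj x x

data Walk {n : ℕ} (G : Graph n) : {l : ℕ} → Vec (Fin n) l → Set where
  []  : Walk G []
  [_] : ∀ x → Walk G (x ∷ [])
  _∷_ : ∀ {l x y} {xs : Vec (Fin n) l} →
        Graph.Adj G x y → Walk G (y ∷ xs) → Walk G (x ∷ y ∷ xs)

-- An l-path: a simple path with exactly l vertices, given by its vertex
-- sequence (pairwise distinct, consecutive vertices adjacent).
record Path {n : ℕ} (G : Graph n) (l : ℕ) : Set where
  constructor path
  field
    verts  : Vec (Fin n) l
    walk   : Walk G verts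
    simple : Unique verts

_∈V_ : ∀ {n} {G : Graph n} {l} → Fin n → Path G l → Set
x ∈V P = x ∈ Path.verts P

SameVertexSet : ∀ {n} {G : Graph n} {l} → Path G l → Path G l → Set
SameVertexSet P P' = ∀ x → (x ∈V P → x ∈V P') × (x ∈V P' → x ∈V P)

IsVPath : ∀ {n} {G : Graph n} {l} → Fin n → Path G l → Set
IsVPath v P = v ∈V P

Intersecting : ∀ {n} {G : Graph n} {l} → Fin n → Path G l → Path G l → Set
Intersecting v P P' =
  ¬ SameVertexSet P P' × (∃[ u ] (¬ u ≡ v × u ∈V P × u ∈V P'))

module Submission where

-- If two v-paths P, P' met only in v, then splicing the longer arm of P at v with the
-- longer arm of P' at v (each has at least (l - 1)/2 vertices besides v) would give a
-- v-path Q with l vertices meeting both P and P' outside v. As Q and P do not intersect,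
-- Q has the vertex set of P, so the vertex of P' on Q lies in P: contradiction. Hence P
-- and P' meet outside v, and then their vertex sets agree. Arguing by contradiction is
-- harmless here since membership in a vertex sequence is decidable.

open import Defs
open import Level using (_⊔_)
open import Data.Nat using (ℕ; zero; suc; _+_; _≤_; _<_; _≥_; _≤?_; s≤s; ⌊_/2⌋; ⌈_/2⌉)
open import Data.Nat.Properties
  using (+-suc; +-monoˡ-≤; ≤-trans; ≤-pred; <⇒≤; ≰⇒>; m≤n⇒m⊓n≡m; ⌈n/2⌉-mono; ⌊n/2⌋-mono; ⌊n/2⌋≤⌈n/2⌉; ⌊n/2⌋+⌈n/2⌉≡n; module ≤-Reasoning)
open import Data.List using (List; []; _∷_; _++_; _ʳ++_; reverse; take; length)
open import Data.List.Properties using (length-++; length-ʳ++; length-reverse; length-take; ++-ʳ++; ʳ++-defn)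
open import Data.List.Membership.Propositional using (_∈_)
open import Data.List.Membership.Propositional.Properties using (∈-∃++; ∈-++⁺ʳ)
open import Data.List.Relation.Unary.Any using (here; there)
open import Data.List.Relation.Unary.Any.Properties using (reverseAcc⁺; reverse⁻)
open import Data.List.Relation.Unary.All as All using (All)
open import Data.List.Relation.Unary.AllPairs as AllPairs using (_∷_)
open import Data.List.Relation.Unary.Linked as Linked using (Linked; []; [-]; _∷_)
open import Data.List.Relation.Unary.Unique.Propositional using (Unique)
open import Data.List.Relation.Unary.Unique.Propositional.Properties using (++⁺; take⁺)
open import Data.List.Relation.Binary.Disjoint.Propositional using (Disjoint)
open import Data.List.Relation.Binary.Permutation.Propositional using (↭⇒↭ₛ; ↭-sym)
open import Data.List.Relation.Binary.Permutation.Propositional.Properties using (++↭ʳ++; ↭-reverse)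
import Data.List.Relation.Binary.Permutation.Setoid.Properties as Permutationₛ
open import Data.Product using (∃-syntax; _×_; _,_; proj₁; proj₂)
open import Data.Sum using (inj₁; inj₂)
open import Relation.Binary.Core using (Rel)
open import Relation.Binary.Definitions using (Symmetric)
open import Relation.Binary.PropositionalEquality using (_≡_; _≢_; refl; sym; trans; cong; cong₂; subst; module ≡-Reasoning)
open import Function using (_∘_)
import Relation.Binary.PropositionalEquality.Properties as ≡
open import Relation.Nullary using (¬_; yes; no)
open import Relation.Nullary.Decidable using (decidable-stable)
open import Data.Fin using (Fin; _≟_)
open import Data.Vec using (Vec; toList; fromList)
open import Data.Vec.Properties using (length-toList)
import Data.Vec.Membership.DecPropositional as VecMembership
open import Data.Vec.Membership.Propositional.Properties using (∈-toList⁺; ∈-toList⁻; ∈-fromList⁺)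
import Data.Vec.Relation.Unary.All.Properties as VecAll
import Data.Vec.Relation.Unary.AllPairs as VecAllPairs
import Data.Vec.Relation.Unary.Unique.Propositional as Vec

⌈n+n/2⌉≡n : ∀ n → ⌈ n + n /2⌉ ≡ n
⌈n+n/2⌉≡n zero    = refl
⌈n+n/2⌉≡n (suc n) = cong suc (trans (cong ⌊_/2⌋ (+-suc n n)) (⌈n+n/2⌉≡n n))

n≤m+m⇒⌈n/2⌉≤m : ∀ {n m} → n ≤ m + m → ⌈ n /2⌉ ≤ m
n≤m+m⇒⌈n/2⌉≤m {m = m} n≤m+m = subst (_ ≤_) (⌈n+n/2⌉≡n m) (⌈n/2⌉-mono n≤m+m)

module _ {a} {A : Set a} where

  ∈-take⁻ : ∀ {x : A} n xs → x ∈ take n xs → x ∈ xs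
  ∈-take⁻ (suc n) (y ∷ xs) (here x≡y)  = here x≡y
  ∈-take⁻ (suc n) (y ∷ xs) (there x∈) = there (∈-take⁻ n xs x∈)

  ∃∈-take : ∀ {k} {xs : List A} → 0 < k → k ≤ length xs → ∃[ x ] x ∈ take k xs
  ∃∈-take {suc _} {x ∷ _} _ _ = x , here refl

  module _ {ℓ} {R : Rel A ℓ} where

    Linked-take⁺ : ∀ n {xs} → Linked R xs → Linked R (take n xs)
    Linked-take⁺ zero          _        = []
    Linked-take⁺ (suc n)       []       = []
    Linked-take⁺ (suc zero)    {_ ∷ _} _ = [-]
    Linked-take⁺ (suc (suc n)) [-]      = [-]
    Linked-take⁺ (suc (suc n)) (r ∷ rs) = r ∷ Linked-take⁺ (suc n) rs

    Linked-++⁻ʳ : ∀ xs {ys} → Linked R (xs ++ ys) → Linked R ys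
    Linked-++⁻ʳ []       l = l
    Linked-++⁻ʳ (_ ∷ xs) l = Linked-++⁻ʳ xs (Linked.tail l)

    module _ (R-sym : Symmetric R) where

      Linked-ʳ++⁺ : ∀ {x xs ys} → Linked R (x ∷ xs) → Linked R (x ∷ ys) → Linked R (xs ʳ++ x ∷ ys)
      Linked-ʳ++⁺ [-]      l = l
      Linked-ʳ++⁺ (r ∷ rs) l = Linked-ʳ++⁺ rs (R-sym r ∷ l)

      Linked-reverse⁺ : ∀ {xs} → Linked R xs → Linked R (reverse xs)
      Linked-reverse⁺ []      = []
      Linked-reverse⁺ {_ ∷ _} l = Linked-ʳ++⁺ l [-]

  open Permutationₛ (≡.setoid A) using (Unique-resp-↭)

  Unique-++⁻ʳ : ∀ (xs : List A) {ys} → Unique (xs ++ ys) → Unique ys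
  Unique-++⁻ʳ []       u       = u
  Unique-++⁻ʳ (_ ∷ xs) (_ ∷ u) = Unique-++⁻ʳ xs u

  Unique-ʳ++⁺ : ∀ {x : A} {xs ys} → Unique (x ∷ xs) → Unique (x ∷ ys) → Disjoint xs ys →
                Unique (xs ʳ++ x ∷ ys)
  Unique-ʳ++⁺ {x = x} {xs} {ys} (x∉xs ∷ uxs) uys xs∩ys=∅ =
    Unique-resp-↭ (↭⇒↭ₛ (++↭ʳ++ xs (x ∷ ys))) (++⁺ uxs uys xs∩x∷ys=∅)
    where
    xs∩x∷ys=∅ : Disjoint xs (x ∷ ys)
    xs∩x∷ys=∅ (y∈xs , here y≡x)  = All.lookup x∉xs y∈xs (sym y≡x)
    xs∩x∷ys=∅ (y∈xs , there y∈ys) = xs∩ys=∅ (y∈xs , y∈ys)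

  Unique-reverse⁺ : ∀ {xs : List A} → Unique xs → Unique (reverse xs)
  Unique-reverse⁺ {xs = xs} = Unique-resp-↭ (↭⇒↭ₛ (↭-sym (↭-reverse xs)))

  Unique-toList⁺ : ∀ {l} {xs : Vec A l} → Vec.Unique xs → Unique (toList xs)
  Unique-toList⁺ VecAllPairs.[]         = AllPairs.[]
  Unique-toList⁺ (x∉xs VecAllPairs.∷ u) = VecAll.toList⁺ x∉xs ∷ Unique-toList⁺ u

  Unique-fromList⁺ : ∀ {xs : List A} → Unique xs → Vec.Unique (fromList xs)
  Unique-fromList⁺ AllPairs.[]  = VecAllPairs.[]
  Unique-fromList⁺ (x∉xs ∷ u)   = VecAll.fromList⁺ x∉xs VecAllPairs.∷ Unique-fromList⁺ u

  length-take-≤ : ∀ {n} {xs : List A} → n ≤ length xs → length (take n xs) ≡ n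
  length-take-≤ {n} {xs} n≤ = trans (length-take n xs) (m≤n⇒m⊓n≡m n≤)

  CommonBesides : A → List A → List A → Set a
  CommonBesides v xs ys = ∃[ u ] (u ≢ v × u ∈ xs × u ∈ ys)

  module _ {ℓ} {R : Rel A ℓ} (R-sym : Symmetric R) where

    record Arm (v : A) (xs : List A) : Set (a ⊔ ℓ) where
      field
        arm    : List A
        linked : Linked R (v ∷ arm)
        unique : Unique (v ∷ arm)
        arm⊆   : ∀ {x} → x ∈ arm → x ∈ xs
        long   : length xs ≤ suc (length arm + length arm)

      ∈arm⇒≢ : ∀ {x} → x ∈ arm → x ≢ v
      ∈arm⇒≢ x∈arm x≡v = All.lookup (AllPairs.head unique) x∈arm (sym x≡v)

    suffixArm : ∀ {v xs} ys zs → xs ≡ ys ++ v ∷ zs → Linked R xs → Unique xs →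
                length ys ≤ length zs → Arm v xs
    suffixArm {v} ys zs refl l u ys≤zs = record
      { arm    = zs
      ; linked = Linked-++⁻ʳ ys l
      ; unique = Unique-++⁻ʳ ys u
      ; arm⊆   = ∈-++⁺ʳ ys ∘ there
      ; long   = begin
          length (ys ++ v ∷ zs)       ≡⟨ length-++ ys ⟩
          length ys + suc (length zs) ≤⟨ +-monoˡ-≤ _ ys≤zs ⟩
          length zs + suc (length zs) ≡⟨ +-suc (length zs) (length zs) ⟩
          suc (length zs + length zs) ∎
      }
      where open ≤-Reasoning

    reverseArm : ∀ {v xs} → Arm v (reverse xs) → Arm v xs
    reverseArm {xs = xs} α = record
      { arm    = arm
      ; linked = linked
      ; unique = unique
      ; arm⊆   = reverse⁻ ∘ arm⊆
      ; long   = subst (_≤ _) (length-reverse xs) long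
      }
      where open Arm α

    longArm : ∀ {v xs} → v ∈ xs → Linked R xs → Unique xs → Arm v xs
    longArm {v} {xs} v∈xs l u with ys , zs , xs≡ ← ∈-∃++ v∈xs | length ys ≤? length zs
    ... | yes ys≤zs = suffixArm ys zs xs≡ l u ys≤zs
    ... | no  ys≰zs = reverseArm (suffixArm (reverse zs) (reverse ys) reverse-xs≡
                        (Linked-reverse⁺ R-sym l) (Unique-reverse⁺ u) |zs|≤|ys|)
      where
      open ≡-Reasoning
      reverse-xs≡ : reverse xs ≡ reverse zs ++ v ∷ reverse ys
      reverse-xs≡ = begin
        reverse xs                  ≡⟨ cong reverse xs≡ ⟩
        (ys ++ v ∷ zs) ʳ++ []       ≡⟨ ++-ʳ++ ys ⟩
        zs ʳ++ v ∷ reverse ys       ≡⟨ ʳ++-defn zs ⟩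
        reverse zs ++ v ∷ reverse ys ∎
      |zs|≤|ys| : length (reverse zs) ≤ length (reverse ys)
      |zs|≤|ys| rewrite length-reverse zs | length-reverse ys = <⇒≤ (≰⇒> ys≰zs)

    record CrossWalk (v : A) (xs ys : List A) (l : ℕ) : Set (a ⊔ ℓ) where
      field
        walk    : List A
        length≡ : length walk ≡ l
        linked  : Linked R walk
        unique  : Unique walk
        v∈walk  : v ∈ walk
        meets₁  : CommonBesides v xs walk
        meets₂  : CommonBesides v ys walk

    joinArms : ∀ {v xs ys k m} (α : Arm v xs) (β : Arm v ys) → Disjoint (Arm.arm α) (Arm.arm β) →
               0 < k → k ≤ length (Arm.arm α) → 0 < m → m ≤ length (Arm.arm β) →
               CrossWalk v xs ys (suc (k + m))
    joinArms {v} {k = k} {m} α β arms∩=∅ 0<k k≤ 0<m m≤ = record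
      { walk    = front ʳ++ v ∷ back
      ; length≡ = begin
          length (front ʳ++ v ∷ back)     ≡⟨ length-ʳ++ front ⟩
          length front + suc (length back) ≡⟨ cong₂ (λ i j → i + suc j) (length-take-≤ k≤) (length-take-≤ m≤) ⟩
          k + suc m                        ≡⟨ +-suc k m ⟩
          suc (k + m)                      ∎
      ; linked  = Linked-ʳ++⁺ R-sym (Linked-take⁺ (suc k) α.linked) (Linked-take⁺ (suc m) β.linked)
      ; unique  = Unique-ʳ++⁺ (take⁺ (suc k) α.unique) (take⁺ (suc m) β.unique)
                    (λ (x∈ , y∈) → arms∩=∅ (∈-take⁻ k _ x∈ , ∈-take⁻ m _ y∈))
      ; v∈walk  = reverseAcc⁺ _ front (inj₁ (here refl))
      ; meets₁  = let u , u∈front = ∃∈-take 0<k k≤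
                      u∈arm = ∈-take⁻ k _ u∈front
                  in u , α.∈arm⇒≢ u∈arm , α.arm⊆ u∈arm , reverseAcc⁺ _ front (inj₂ u∈front)
      ; meets₂  = let w , w∈back = ∃∈-take 0<m m≤
                      w∈arm = ∈-take⁻ m _ w∈back
                  in w , β.∈arm⇒≢ w∈arm , β.arm⊆ w∈arm , reverseAcc⁺ _ front (inj₁ (there w∈back))
      }
      where
      module α = Arm α
      module β = Arm β
      front = take k α.arm
      back  = take m β.arm
      open ≡-Reasoning

    crossWalk : ∀ {v xs ys l} → 3 ≤ l → length xs ≡ l → length ys ≡ l →
                v ∈ xs → Linked R xs → Unique xs → v ∈ ys → Linked R ys → Unique ys →
                ¬ CommonBesides v xs ys → CrossWalk v xs ys l
    -- Of the L = l - 1 vertices other than v, ⌊ L /2⌋ come from the arm of xs and ⌈ L /2⌉ from that of ys.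
    crossWalk {v} {l = suc L} (s≤s 2≤L) |xs|≡l |ys|≡l v∈xs lxs uxs v∈ys lys uys no-common =
      subst (CrossWalk v _ _) (cong suc (⌊n/2⌋+⌈n/2⌉≡n L))
        (joinArms α β arms∩=∅ 0<k (≤-trans k≤m (n≤m+m⇒⌈n/2⌉≤m (half α |xs|≡l)))
                             0<m (n≤m+m⇒⌈n/2⌉≤m (half β |ys|≡l)))
      where
      α = longArm v∈xs lxs uxs
      β = longArm v∈ys lys uys
      k≤m = ⌊n/2⌋≤⌈n/2⌉ L
      0<k = ⌊n/2⌋-mono 2≤L
      0<m = ≤-trans 0<k k≤m
      half : ∀ {zs} (γ : Arm v zs) → length zs ≡ suc L → L ≤ length (Arm.arm γ) + length (Arm.arm γ)
      half γ |zs|≡l = ≤-pred (subst (_≤ _) |zs|≡l (Arm.long γ))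
      arms∩=∅ : Disjoint (Arm.arm α) (Arm.arm β)
      arms∩=∅ (x∈α , x∈β) = no-common (_ , Arm.∈arm⇒≢ α x∈α , Arm.arm⊆ α x∈α , Arm.arm⊆ β x∈β)

module _ {n} {G : Graph n} where
  open Graph G using (Adj) renaming (sym to Adj-sym)

  SharedBesides : ∀ {l} → Fin n → Path G l → Path G l → Set
  SharedBesides v P Q = ∃[ u ] (¬ u ≡ v × u ∈V P × u ∈V Q)

  vertices : ∀ {l} → Path G l → List (Fin n)
  vertices = toList ∘ Path.verts

  Walk⇒Linked : ∀ {l} {xs : Vec (Fin n) l} → Walk G xs → Linked Adj (toList xs)
  Walk⇒Linked []      = []
  Walk⇒Linked [ _ ]   = [-]
  Walk⇒Linked (e ∷ w) = e ∷ Walk⇒Linked w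

  Linked⇒Walk : ∀ {xs} → Linked Adj xs → Walk G (fromList xs)
  Linked⇒Walk []       = []
  Linked⇒Walk [-]      = [ _ ]
  Linked⇒Walk (e ∷ es) = e ∷ Linked⇒Walk es

  fromSimpleList : ∀ {l} xs → length xs ≡ l → Linked Adj xs → Unique xs → Path G l
  fromSimpleList xs refl lxs uxs = path (fromList xs) (Linked⇒Walk lxs) (Unique-fromList⁺ uxs)

  ∈-fromSimpleList⁺ : ∀ {l x} xs (|xs|≡l : length xs ≡ l) lxs uxs →
                      x ∈ xs → x ∈V fromSimpleList xs |xs|≡l lxs uxs
  ∈-fromSimpleList⁺ xs refl _ _ = ∈-fromList⁺

  crossPath : ∀ {l v} (P P' : Path G l) → 3 ≤ l → IsVPath v P → IsVPath v P' →
              ¬ SharedBesides v P P' → ∃[ Q ] (IsVPath v Q × SharedBesides v P Q × SharedBesides v P' Q)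
  crossPath {l} {v} P P' l≥3 v∈P v∈P' no-shared = Q , ∈Q v∈walk , shared P meets₁ , shared P' meets₂
    where
    cross = crossWalk Adj-sym l≥3 (length-toList (Path.verts P)) (length-toList (Path.verts P'))
              (∈-toList⁺ v∈P) (Walk⇒Linked (Path.walk P)) (Unique-toList⁺ (Path.simple P))
              (∈-toList⁺ v∈P') (Walk⇒Linked (Path.walk P')) (Unique-toList⁺ (Path.simple P'))
              (λ (u , u≢v , u∈P , u∈P') → no-shared (u , u≢v , ∈-toList⁻ u∈P , ∈-toList⁻ u∈P'))
    open CrossWalk cross
    Q = fromSimpleList walk length≡ linked unique
    ∈Q : ∀ {x} → x ∈ walk → x ∈V Q
    ∈Q = ∈-fromSimpleList⁺ walk length≡ linked unique
    shared : ∀ R → CommonBesides v (vertices R) walk → SharedBesides v R Q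
    shared _ (u , u≢v , u∈R , u∈walk) = u , u≢v , ∈-toList⁻ u∈R , ∈Q u∈walk

  SameVertexSet-stable : ∀ {l} (P P' : Path G l) → ¬ ¬ SameVertexSet P P' → SameVertexSet P P'
  SameVertexSet-stable P P' ¬¬same x =
      (λ x∈P  → decidable-stable (x ∈? Path.verts P') (λ x∉P' → ¬¬same λ same → x∉P' (proj₁ (same x) x∈P)))
    , (λ x∈P' → decidable-stable (x ∈? Path.verts P)  (λ x∉P  → ¬¬same λ same → x∉P  (proj₂ (same x) x∈P')))
    where open VecMembership (_≟_ {n}) using (_∈?_)

lemma3 : (l : ℕ) → l ≥ 3 → (n : ℕ) (G : Graph n) (v : Fin n) →
    (∀ (P P' : Path G l) → IsVPath v P → IsVPath v P' → ¬ Intersecting v P P') →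
    ∀ (P P' : Path G l) → IsVPath v P → IsVPath v P' → SameVertexSet P P'
lemma3 l l≥3 n G v no-intersecting P P' v∈P v∈P' = SameVertexSet-stable P P' λ P≉P' →
  let no-shared = λ shared → no-intersecting P P' v∈P v∈P' (P≉P' , shared)
      Q , v∈Q , P∩Q , (w , w≢v , w∈P' , w∈Q) = crossPath P P' l≥3 v∈P v∈P' no-shared
      P≈Q = SameVertexSet-stable P Q λ P≉Q → no-intersecting P Q v∈P v∈Q (P≉Q , P∩Q)
  in no-shared (w , w≢v , proj₂ (P≈Q w) w∈Q , w∈P')
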